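{- For all integers $n\ge 3$, \[ \left\lceil \log_2 \left\lceil \log_2 n\right\rceil\right\rceil \le \chi\big(J_\pm(n,3,-2)\big)\le 4\left\lceil \log_2 \left\lceil \log_2 n\right\rceil\right\rceil+6, \] where $J_\pm(n,3,-2)$ is the graph whose vertex set consists of all vectors $v\in\{ -1,0,1\}^n$ with exactly $3$ nonzero coordinates, two vertices being adjacent if and only if their standard scalar product equals $-2$.
   Context: $\chi(G)$ denotes the chromatic number of $G$: the minimum number of colors in a coloring of the vertices such that adjacent vertices receive different colors. -}

module Defs where

open import Data.Nat using (ℕ; zero; suc; _+_; _≤_)
open import Data.Fin using (Fin)
open import Data.Vec using (Vec; []; _∷_)
open import Data.Integer using (ℤ; +_; -[1+_]) renaming (_+_ to _+ℤ_; _*_ to _*ℤ_)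
open import Data.Product using (Σ; _×_)
open import Relation.Binary.PropositionalEquality using (_≡_; _≢_)
open import Level using (Level; _⊔_)

record Graph (v e : Level) : Set (Level.suc (v ⊔ e)) where
  field
    V   : Set v
    Adj : V → V → Set e

open Graph public

ProperColouring : ∀ {v e} → Graph v e → ℕ → Set (v ⊔ e)
ProperColouring G k =
  Σ (V G → Fin k) λ c → ∀ x y → Adj G x y → c x ≢ c y

IsChromaticNumber : ∀ {v e} → Graph v e → ℕ → Set (v ⊔ e)
IsChromaticNumber G χ =
  ProperColouring G χ × (∀ k → ProperColouring G k → χ ≤ k)

data Trit : Set where
  neg zer pos : Trit

toℤ : Trit → ℤ
toℤ neg = -[1+ 0 ]
toℤ zer = + 0
toℤ pos = + 1

support : ∀ {n} → Vec Trit n → ℕ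
support []          = 0
support (zer ∷ xs)  = support xs
support (neg ∷ xs)  = suc (support xs)
support (pos ∷ xs)  = suc (support xs)

dot : ∀ {n} → Vec Trit n → Vec Trit n → ℤ
dot []       []       = + 0
dot (x ∷ xs) (y ∷ ys) = (toℤ x *ℤ toℤ y) +ℤ dot xs ys

J± : ℕ → Graph Level.zero Level.zero
J± n = record
  { V   = Σ (Vec Trit n) (λ x → support x ≡ 3)
  ; Adj = λ x y → dot (Data.Product.proj₁ x) (Data.Product.proj₁ y) ≡ -[1+ 1 ]
  }

-- Lower bound: the vectors e_i − e_j + e_l (i < j < l) form a copy of the shift graph on
-- triples, since e_i − e_j + e_l and e_j − e_l + e_m have scalar product −2. A proper
-- k-colouring of the triple shift graph on n points forces n ≤ 2 ^ 2 ^ k: the set of colours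
-- seen above a pair colours the pair shift graph with 2 ^ k colours, and the set of those
-- colours seen above a point separates all n points.
--
-- Upper bound: colour a vertex by its sign pattern. Two vertices with the same pattern and
-- scalar product −2 share two coordinates, where their signs are opposite; this forces the
-- pattern to alternate (+ − + or − + −) and the supports to look like (i, j, l) and (j, l, m).
-- So the six other patterns need one colour each, and the two alternating ones a colouring
-- of the triple shift graph, which binary expansions provide with 2 ⌈log₂ ⌈log₂ n⌉⌉ colours.
module Submission where

open import Defs
open import Data.Bool using (Bool; true; false; T; if_then_else_)
import Data.Bool.Properties as Bool
open import Data.Fin as Fin using (Fin; #_; toℕ; fromℕ<; combine)
import Data.Fin.Properties as Fin
open import Data.Fin.Subset using (Subset)
open import Data.Integer using (ℤ; -[1+_]; _◃_) renaming (_+_ to _+ℤ_; _*_ to _*ℤ_)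
import Data.Integer as ℤ
import Data.Integer.Properties as ℤ
open import Algebra.Properties.CommutativeSemigroup ℤ.+-commutativeSemigroup using (x∙yz≈y∙xz)
open import Data.List as List
  using (List; []; _∷_; _++_; map; mapMaybe; length; cartesianProductWith)
open import Data.List.Membership.Propositional using (_∈_)
open import Data.List.Membership.Propositional.Properties
  using (∈-map⁺; ∈-++⁺ˡ; ∈-++⁺ʳ; ∈-cartesianProductWith⁺)
open import Data.List.Relation.Unary.All as All using (All; []; _∷_)
open import Data.List.Relation.Unary.AllPairs using (AllPairs; []; _∷_)
import Data.List.Relation.Unary.Any as Any
open import Data.List.Relation.Unary.Any using (here; there)
open import Data.List.Relation.Unary.Any.Properties using (lookup-index)
open import Data.Maybe using (Maybe; just; nothing; maybe; is-just; _>>=_; to-witness-T)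
open import Data.Nat
open import Data.Nat.Properties
open import Data.Nat.Induction using (<-wellFounded)
open import Data.Nat.Logarithm using (⌈log₂_⌉; ⌈log₂⌉-mono-≤; ⌈log₂2^n⌉≡n)
open import Data.Nat.Logarithm.Core using (⌈log2⌉)
open import Data.Nat.Tactic.RingSolver using (solve-∀)
open import Data.Product using (Σ; ∃; ∃-syntax; _×_; _,_; proj₁; proj₂; map₂)
open import Data.Sign as Sign using (Sign)
open import Data.Sum using (_⊎_; inj₁; inj₂; [_,_]′)
import Data.Sum.Properties as Sum
open import Data.Vec using (Vec; []; _∷_; lookup; tabulate; toList; fromList)
open import Data.Vec.Properties using (lookup∘tabulate; toList∘fromList)
open import Function using (_∘_; const; case_of_; Injective)
open import Induction.WellFounded using (Acc; acc)
open import Relation.Binary using (tri<; tri≈; tri>)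
open import Relation.Binary.PropositionalEquality
open import Relation.Nullary using (Dec; yes; no; does; ¬_; contradiction)
open import Relation.Nullary.Decidable
  using (map′; dec-true; dec-false; toWitness; T?; ¬?; _×-dec_; _→-dec_)
open import Relation.Unary using (Decidable)

-- Finite graphs

least : ∀ {p} {P : ℕ → Set p} → Decidable P → ∀ {K} → P K →
        ∃[ χ ] P χ × χ ≤ K × (∀ {k} → k < χ → ¬ P k)
least {P = P} P? {K} PK = go K (<-wellFounded K) PK
  where
  go : ∀ K → Acc _<_ K → P K → ∃[ χ ] P χ × χ ≤ K × (∀ {k} → k < χ → ¬ P k)
  go K (acc smaller) PK with anyUpTo? P? K
  ... | no none = K , PK , ≤-refl , λ k<K Pk → none (_ , k<K , Pk)
  ... | yes (k , k<K , Pk) with χ , Pχ , χ≤k , minimal ← go k (smaller k<K) Pk =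
    χ , Pχ , ≤-trans χ≤k (<⇒≤ k<K) , minimal

anyVec? : ∀ {p k} n {P : Vec (Fin k) n → Set p} → Decidable P → Dec (∃ P)
anyVec? zero    P? = map′ ([] ,_) (λ { ([] , p) → p }) (P? [])
anyVec? (suc n) P? = map′ (λ { (x , xs , p) → x ∷ xs , p }) (λ { (x ∷ xs , p) → x , xs , p })
                          (Fin.any? λ x → anyVec? n (P? ∘ (x ∷_)))

module FiniteGraph {v e} (G : Graph v e) (vertices : List (V G)) (complete : ∀ x → x ∈ vertices)
                   (adjacent? : ∀ x y → Dec (Adj G x y)) where

  private
    N = length vertices

    vertex : Fin N → V G
    vertex = List.lookup vertices

    index : V G → Fin N
    index x = Any.index (complete x)

    vertex-index : ∀ x → vertex (index x) ≡ x
    vertex-index x = sym (lookup-index (complete x))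

    ProperOnIndices : ∀ {k} → Vec (Fin k) N → Set e
    ProperOnIndices c = ∀ i j → Adj G (vertex i) (vertex j) → lookup c i ≢ lookup c j

  colourable? : ∀ k → Dec (ProperColouring G k)
  colourable? k = map′ fromIndices toIndices (anyVec? N properOnIndices?)
    where
    properOnIndices? : (c : Vec (Fin k) N) → Dec (ProperOnIndices c)
    properOnIndices? c = Fin.all? λ i → Fin.all? λ j →
                           adjacent? (vertex i) (vertex j) →-dec ¬? (lookup c i Fin.≟ lookup c j)
    fromIndices : ∃ ProperOnIndices → ProperColouring G k
    fromIndices (c , proper) = lookup c ∘ index , λ x y adj →
      proper (index x) (index y) (subst₂ (Adj G) (sym (vertex-index x)) (sym (vertex-index y)) adj)
    toIndices : ProperColouring G k → ∃ ProperOnIndices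
    toIndices (c , proper) = tabulate (c ∘ vertex) , λ i j adj same →
      proper (vertex i) (vertex j) adj
        (trans (sym (lookup∘tabulate _ i)) (trans same (lookup∘tabulate _ j)))

  chromaticNumber : ∀ {K} → ProperColouring G K → ∃[ χ ] IsChromaticNumber G χ × χ ≤ K
  chromaticNumber colouring with χ , χ-colouring , χ≤K , fewer ← least colourable? colouring =
    χ , (χ-colouring , λ k k-colouring → ≮⇒≥ λ k<χ → fewer k<χ k-colouring) , χ≤K

boundedColouring : ∀ {v e} {G : Graph v e} {K} (c : V G → ℕ) → (∀ x → c x < K) →
                   (∀ x y → Adj G x y → c x ≢ c y) → ProperColouring G K
boundedColouring c c< proper = (λ x → fromℕ< (c< x)) , λ x y adj same →
  proper x y adj
    (trans (sym (Fin.toℕ-fromℕ< (c< x))) (trans (cong toℕ same) (Fin.toℕ-fromℕ< (c< y))))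

vectors : ∀ {A : Set} → List A → ∀ n → List (Vec A n)
vectors xs zero    = [] ∷ []
vectors xs (suc n) = cartesianProductWith _∷_ xs (vectors xs n)

∈-vectors : ∀ {A : Set} {xs : List A} → (∀ x → x ∈ xs) → ∀ {n} (v : Vec A n) → v ∈ vectors xs n
∈-vectors _    []      = here refl
∈-vectors all∈ (x ∷ v) = ∈-cartesianProductWith⁺ _∷_ (all∈ x) (∈-vectors all∈ v)

module _ {A : Set} {P : A → Set} (P? : Decidable P) where

  withProofs : List A → List (Σ A P)
  withProofs []       = []
  withProofs (x ∷ xs) with P? x
  ... | yes p = (x , p) ∷ withProofs xs
  ... | no _  = withProofs xs

  ∈-withProofs : (∀ {x} (p q : P x) → p ≡ q) → ∀ {x xs} (p : P x) → x ∈ xs → (x , p) ∈ withProofs xs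
  ∈-withProofs irrelevant {x} p (here refl) with P? x
  ... | yes p′ = here (cong (x ,_) (irrelevant p p′))
  ... | no ¬p  = contradiction p ¬p
  ∈-withProofs irrelevant {xs = y ∷ _} p (there x∈) with P? y
  ... | yes _ = there (∈-withProofs irrelevant p x∈)
  ... | no _  = ∈-withProofs irrelevant p x∈

-- Logarithms

n≤2^⌈log₂n⌉ : ∀ n → n ≤ 2 ^ ⌈log₂ n ⌉
n≤2^⌈log₂n⌉ n = go n (<-wellFounded n)
  where
  go : ∀ n (rec : Acc _<_ n) → n ≤ 2 ^ ⌈log2⌉ n rec
  go 0 _ = z≤n
  go 1 _ = s≤s z≤n
  go (suc (suc n)) (acc smaller) = begin
    2 + n                   ≤⟨ s≤s (s≤s n≤⌈n/2⌉+⌈n/2⌉) ⟩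
    2 + (⌈ n /2⌉ + ⌈ n /2⌉) ≡⟨ cong suc (sym (+-suc ⌈ n /2⌉ _)) ⟩
    h + h                   ≡⟨ cong (h +_) (sym (+-identityʳ h)) ⟩
    2 * h                   ≤⟨ *-monoʳ-≤ 2 (go h (smaller (⌈n/2⌉<n n))) ⟩
    2 * 2 ^ ⌈log2⌉ h _      ∎
    where
    open ≤-Reasoning
    h = suc ⌈ n /2⌉
    n≤⌈n/2⌉+⌈n/2⌉ : n ≤ ⌈ n /2⌉ + ⌈ n /2⌉
    n≤⌈n/2⌉+⌈n/2⌉ = subst (_≤ ⌈ n /2⌉ + ⌈ n /2⌉) (⌊n/2⌋+⌈n/2⌉≡n n)
                      (+-monoˡ-≤ ⌈ n /2⌉ (⌊n/2⌋≤⌈n/2⌉ n))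

n≤2^2^k⇒⌈log₂⌈log₂n⌉⌉≤k : ∀ {n k} → n ≤ 2 ^ 2 ^ k → ⌈log₂ ⌈log₂ n ⌉ ⌉ ≤ k
n≤2^2^k⇒⌈log₂⌈log₂n⌉⌉≤k {n} {k} n≤ = subst (⌈log₂ ⌈log₂ n ⌉ ⌉ ≤_) (⌈log₂2^n⌉≡n k)
  (⌈log₂⌉-mono-≤ (subst (⌈log₂ n ⌉ ≤_) (⌈log₂2^n⌉≡n (2 ^ k)) (⌈log₂⌉-mono-≤ n≤)))

-- Binary digits

consBit : Bool → ℕ → ℕ
consBit b zero    = if b then 1 else 0
consBit b (suc h) = suc (suc (consBit b h))

lowBit : ℕ → Bool
lowBit zero          = false
lowBit (suc zero)    = true
lowBit (suc (suc x)) = lowBit x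

bit : ℕ → ℕ → Bool
bit zero    x = lowBit x
bit (suc i) x = bit i ⌊ x /2⌋

lowBit-consBit : ∀ b h → lowBit (consBit b h) ≡ b
lowBit-consBit false zero    = refl
lowBit-consBit true  zero    = refl
lowBit-consBit b     (suc h) = lowBit-consBit b h

⌊consBit/2⌋ : ∀ b h → ⌊ consBit b h /2⌋ ≡ h
⌊consBit/2⌋ false zero    = refl
⌊consBit/2⌋ true  zero    = refl
⌊consBit/2⌋ b     (suc h) = cong suc (⌊consBit/2⌋ b h)

consBit-lowBit : ∀ x → consBit (lowBit x) ⌊ x /2⌋ ≡ x
consBit-lowBit zero          = refl
consBit-lowBit (suc zero)    = refl
consBit-lowBit (suc (suc x)) = cong (suc ∘ suc) (consBit-lowBit x)

consBit-injective : ∀ b h b′ h′ → consBit b h ≡ consBit b′ h′ → b ≡ b′ × h ≡ h′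
consBit-injective b h b′ h′ eq =
  trans (sym (lowBit-consBit b h)) (trans (cong lowBit eq) (lowBit-consBit b′ h′)) ,
  trans (sym (⌊consBit/2⌋ b h)) (trans (cong ⌊_/2⌋ eq) (⌊consBit/2⌋ b′ h′))

consBit-false : ∀ h → consBit false h ≡ 2 * h
consBit-false zero    = refl
consBit-false (suc h) = trans (cong (suc ∘ suc) (consBit-false h)) (sym (*-suc 2 h))

consBit-false≤ : ∀ b h → consBit false h ≤ consBit b h
consBit-false≤ false h       = ≤-refl
consBit-false≤ true  zero    = z≤n
consBit-false≤ true  (suc h) = s≤s (s≤s (consBit-false≤ true h))

consBit-< : ∀ b {h d} → h < d → consBit b h < d + d
consBit-< false {zero}  {suc d} _ = s≤s z≤n
consBit-< true  {zero}  {suc d} _ = s≤s (≤-trans (s≤s z≤n) (m≤n+m (suc d) d))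
consBit-< b     {suc h} {suc d} (s≤s h<d) =
  subst (suc (suc (consBit b h)) <_) (cong suc (sym (+-suc d d)))
        (s≤s (s≤s (consBit-< b h<d)))

⌊/2⌋-< : ∀ {x d} → x < 2 * d → ⌊ x /2⌋ < d
⌊/2⌋-< {x} x<2d = *-cancelˡ-< 2 _ _ (≤-<-trans 2*⌊x/2⌋≤x x<2d)
  where
  2*⌊x/2⌋≤x : 2 * ⌊ x /2⌋ ≤ x
  2*⌊x/2⌋≤x = subst₂ _≤_ (consBit-false ⌊ x /2⌋) (consBit-lowBit x)
                (consBit-false≤ (lowBit x) ⌊ x /2⌋)

bit-separates : ∀ m {a b} → a < b → b < 2 ^ m →
                ∃[ i ] i < m × bit i a ≡ false × bit i b ≡ true
bit-separates zero    a<b (s≤s z≤n) = contradiction a<b λ ()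
bit-separates (suc m) {a} {b} a<b b<2^1+m
  with m≤n⇒m<n∨m≡n (⌊n/2⌋-mono (<⇒≤ a<b))
... | inj₁ halves<
  with i , i<m , aᵢ , bᵢ ← bit-separates m halves< (⌊/2⌋-< b<2^1+m) = suc i , s≤s i<m , aᵢ , bᵢ
... | inj₂ halves≡ = 0 , z<s , lowBits-< {h = ⌊ b /2⌋} (subst₂ _<_ a≡ (sym (consBit-lowBit b)) a<b)
  where
  a≡ : a ≡ consBit (lowBit a) ⌊ b /2⌋
  a≡ = trans (sym (consBit-lowBit a)) (cong (consBit (lowBit a)) halves≡)
  lowBits-< : ∀ {x y h} → consBit x h < consBit y h → x ≡ false × y ≡ true
  lowBits-< {false} {true}  _ = refl , refl
  lowBits-< {false} {false} p = contradiction p (<-irrefl refl)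
  lowBits-< {true}  {true}  p = contradiction p (<-irrefl refl)
  lowBits-< {true}  {false} {h} p = contradiction (consBit-false≤ true h) (<⇒≱ p)

-- Shift graphs

IsShiftColouring₂ : ∀ {a} {A : Set a} → ℕ → (ℕ → ℕ → A) → Set a
IsShiftColouring₂ n c = ∀ {i j l} → i < j → j < l → l < n → c i j ≢ c j l

IsShiftColouring₃ : ∀ {a} {A : Set a} → ℕ → (ℕ → ℕ → ℕ → A) → Set a
IsShiftColouring₃ n c = ∀ {i j l m} → i < j → j < l → l < m → m < n → c i j l ≢ c j l m

witnessBelow : ∀ {p} {P : ℕ → Set p} → Decidable P → ℕ → ℕ
witnessBelow P? m with anyUpTo? P? m
... | yes (i , _) = i
... | no _        = 0

module _ {p} {P : ℕ → Set p} (P? : Decidable P) {m : ℕ} where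

  witnessBelow-< : 0 < m → witnessBelow P? m < m
  witnessBelow-< m>0 with anyUpTo? P? m
  ... | yes (_ , i<m , _) = i<m
  ... | no _              = m>0

  witnessBelow-sound : ∃[ i ] i < m × P i → P (witnessBelow P? m)
  witnessBelow-sound ∃i with anyUpTo? P? m
  ... | yes (_ , _ , Pi) = Pi
  ... | no ∄i            = contradiction ∃i ∄i

bitColour₂ : ℕ → ℕ → ℕ → ℕ
bitColour₂ m a b = witnessBelow (λ i → (bit i a Bool.≟ false) ×-dec (bit i b Bool.≟ true)) m

bitColour₂-< : ∀ {m} a b → 0 < m → bitColour₂ m a b < m
bitColour₂-< a b = witnessBelow-< _

bitColour₂-shift : ∀ m → IsShiftColouring₂ (2 ^ m) (bitColour₂ m)
bitColour₂-shift m {a} {b} {d} a<b b<d d<2^m same = contradiction (trans (sym bTrue) bFalse) λ ()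
  where
  bTrue : bit (bitColour₂ m a b) b ≡ true
  bTrue = proj₂ (witnessBelow-sound _ (bit-separates m a<b (<-trans b<d d<2^m)))
  bFalse : bit (bitColour₂ m a b) b ≡ false
  bFalse = subst (λ i → bit i b ≡ false) (sym same)
             (proj₁ (witnessBelow-sound _ (bit-separates m b<d d<2^m)))

-- The low bit records whether the pair is increasing, so that (x, y) and (y, z) are compared
-- by bitColour₂ on x < y < z or on z < y < x, or are told apart by that bit.
arcColour : ℕ → ℕ → ℕ → ℕ
arcColour m x y with <-cmp x y
... | tri< _ _ _ = consBit false (bitColour₂ m x y)
... | tri≈ _ _ _ = 0
... | tri> _ _ _ = consBit true (bitColour₂ m y x)

arcColour-< : ∀ {m} x y → 0 < m → arcColour m x y < m + m
arcColour-< {m} x y m>0 with <-cmp x y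
... | tri< _ _ _ = consBit-< false (bitColour₂-< x y m>0)
... | tri≈ _ _ _ = ≤-trans m>0 (m≤m+n m m)
... | tri> _ _ _ = consBit-< true (bitColour₂-< y x m>0)

arcColour-proper : ∀ m {x y z} → x ≢ y → y ≢ z → x < 2 ^ m → y < 2 ^ m → z < 2 ^ m →
                   arcColour m x y ≢ arcColour m y z
arcColour-proper m {x} {y} {z} x≢y y≢z x< y< z< with <-cmp x y | <-cmp y z
... | tri≈ _ x≡y _ | _            = contradiction x≡y x≢y
... | _            | tri≈ _ y≡z _ = contradiction y≡z y≢z
... | tri< x<y _ _ | tri< y<z _ _ = bitColour₂-shift m x<y y<z z< ∘ proj₂
  ∘ consBit-injective false (bitColour₂ m x y) false (bitColour₂ m y z)
... | tri> _ _ y<x | tri> _ _ z<y = bitColour₂-shift m z<y y<x x< ∘ sym ∘ proj₂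
  ∘ consBit-injective true (bitColour₂ m y x) true (bitColour₂ m z y)
... | tri< _ _ _   | tri> _ _ _   = (λ ()) ∘ proj₁
  ∘ consBit-injective false (bitColour₂ m x y) true (bitColour₂ m z y)
... | tri> _ _ _   | tri< _ _ _   = (λ ()) ∘ proj₁
  ∘ consBit-injective true (bitColour₂ m y x) false (bitColour₂ m y z)

bitColour₃ : ℕ → ℕ → ℕ → ℕ → ℕ → ℕ
bitColour₃ m l a b d = arcColour l (bitColour₂ m a b) (bitColour₂ m b d)

bitColour₃-< : ∀ {m l} a b d → 0 < l → bitColour₃ m l a b d < l + l
bitColour₃-< {m} a b d = arcColour-< (bitColour₂ m a b) (bitColour₂ m b d)

bitColour₃-shift : ∀ {m l} → 0 < m → m ≤ 2 ^ l → IsShiftColouring₃ (2 ^ m) (bitColour₃ m l)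
bitColour₃-shift {m} {l} m>0 m≤2^l i<j j<k k<o o<2^m =
  arcColour-proper l (bitColour₂-shift m i<j j<k (<-trans k<o o<2^m))
                     (bitColour₂-shift m j<k k<o o<2^m)
                     (colour< _ _) (colour< _ _) (colour< _ _)
  where
  colour< : ∀ a b → bitColour₂ m a b < 2 ^ l
  colour< a b = <-≤-trans (bitColour₂-< a b m>0) m≤2^l

boolIndex : Bool → Fin 2
boolIndex false = Fin.zero
boolIndex true  = Fin.suc Fin.zero

boolIndex-injective : Injective _≡_ _≡_ boolIndex
boolIndex-injective {false} {false} _ = refl
boolIndex-injective {true}  {true}  _ = refl

subsetIndex : ∀ {k} → Subset k → Fin (2 ^ k)
subsetIndex []      = Fin.zero
subsetIndex (b ∷ s) = combine (boolIndex b) (subsetIndex s)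

subsetIndex-injective : ∀ {k} → Injective _≡_ _≡_ (subsetIndex {k})
subsetIndex-injective {x = []}    {[]}    _  = refl
subsetIndex-injective {x = b ∷ s} {c ∷ t} eq
  with b≡c , s≡t ← Fin.combine-injective (boolIndex b) (subsetIndex s)
                                          (boolIndex c) (subsetIndex t) eq =
  cong₂ _∷_ (boolIndex-injective b≡c) (subsetIndex-injective s≡t)

fromDoes : ∀ {p} {P : Set p} (p? : Dec P) → does p? ≡ true → P
fromDoes (yes p) _ = p

above : ∀ {k} → ℕ → ℕ → (ℕ → Fin k) → Subset k
above n j f = tabulate λ t → does (anyUpTo? (λ l → (j <? l) ×-dec (f l Fin.≟ t)) n)

module _ {k} (n j : ℕ) (f : ℕ → Fin k) where

  above-∋ : ∀ {l} → j < l → l < n → lookup (above n j f) (f l) ≡ true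
  above-∋ {l} j<l l<n =
    trans (lookup∘tabulate _ (f l)) (dec-true (anyUpTo? _ n) (l , l<n , j<l , refl))

  above-∋⁻ : ∀ {t} → lookup (above n j f) t ≡ true → ∃[ l ] l < n × j < l × f l ≡ t
  above-∋⁻ {t} t∈ = fromDoes (anyUpTo? _ n) (trans (sym (lookup∘tabulate _ t)) t∈)

above-separates : ∀ {k n j l} {f g : ℕ → Fin k} → j < l → l < n →
                  (∀ {m} → l < m → m < n → f l ≢ g m) → above n j f ≢ above n l g
above-separates {n = n} {j} {l} {f} {g} j<l l<n fl≢gm above≡
  with m , m<n , l<m , gm≡fl ← above-∋⁻ n l g
         (subst (λ s → lookup s (f l) ≡ true) above≡ (above-∋ n j f j<l l<n))
  = fl≢gm l<m m<n (sym gm≡fl)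

shift₂-lower : ∀ {n k} (c : ℕ → ℕ → Fin k) → IsShiftColouring₂ n c → n ≤ 2 ^ k
shift₂-lower {n} {k} c proper = Fin.injective⇒≤ injective
  where
  index : Fin n → Fin (2 ^ k)
  index i = subsetIndex (above n (toℕ i) (c (toℕ i)))
  separated : ∀ {i j : Fin n} → toℕ i < toℕ j → index i ≢ index j
  separated {i} {j} i<j = above-separates i<j (Fin.toℕ<n j) (proper i<j) ∘ subsetIndex-injective
  injective : Injective _≡_ _≡_ index
  injective {i} {j} eq = case Fin.<-cmp i j of λ where
    (tri< i<j _ _) → contradiction eq (separated i<j)
    (tri≈ _ i≡j _) → i≡j
    (tri> _ _ j<i) → contradiction (sym eq) (separated j<i)

shift₃-lower : ∀ {n k} (c : ℕ → ℕ → ℕ → Fin k) → IsShiftColouring₃ n c → n ≤ 2 ^ 2 ^ k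
shift₃-lower {n} {k} c proper = shift₂-lower pairColour pairProper
  where
  pairColour : ℕ → ℕ → Fin (2 ^ k)
  pairColour i j = subsetIndex (above n j (c i j))
  pairProper : IsShiftColouring₂ n pairColour
  pairProper i<j j<l l<n = above-separates j<l l<n (proper i<j j<l) ∘ subsetIndex-injective

-- Scalar products

vec : (n : ℕ) → (ℕ → Trit) → Vec Trit n
vec zero    f = []
vec (suc n) f = f 0 ∷ vec n (f ∘ suc)

spike : ℕ → Trit → (ℕ → Trit) → ℕ → Trit
spike p x f t = if does (t ≟ p) then x else f t

spike-at : ∀ p x f → spike p x f p ≡ x
spike-at p x f = cong (if_then x else f p) (dec-true (p ≟ p) refl)

spike-off : ∀ {p t} x f → t ≢ p → spike p x f t ≡ f t
spike-off {p} {t} x f t≢p = cong (if_then x else f t) (dec-false (t ≟ p) t≢p)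

dot-spike : ∀ {n p} x f g → p < n → f p ≡ zer →
            dot (vec n (spike p x f)) (vec n g) ≡ toℤ x *ℤ toℤ (g p) +ℤ dot (vec n f) (vec n g)
dot-spike {suc n} {zero} x f g _ f0≡zer rewrite f0≡zer =
  cong (toℤ x *ℤ toℤ (g 0) +ℤ_) (sym (ℤ.+-identityˡ _))
dot-spike {suc n} {suc p} x f g (s≤s p<n) fp≡zer =
  trans (cong (toℤ (f 0) *ℤ toℤ (g 0) +ℤ_) (dot-spike x (f ∘ suc) (g ∘ suc) p<n fp≡zer))
        (x∙yz≈y∙xz (toℤ (f 0) *ℤ toℤ (g 0)) (toℤ x *ℤ toℤ (g (suc p))) _)

zeros : ℕ → Trit
zeros _ = zer

dot-zerosˡ : ∀ n g → dot (vec n zeros) (vec n g) ≡ ℤ.+ 0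
dot-zerosˡ zero    g = refl
dot-zerosˡ (suc n) g = trans (ℤ.+-identityˡ _) (dot-zerosˡ n (g ∘ suc))

support≡dot : ∀ {n} (v : Vec Trit n) → ℤ.+ support v ≡ dot v v
support≡dot []        = refl
support≡dot (zer ∷ v) = trans (support≡dot v) (sym (ℤ.+-identityˡ _))
support≡dot (neg ∷ v) = cong (ℤ.+ 1 +ℤ_) (support≡dot v)
support≡dot (pos ∷ v) = cong (ℤ.+ 1 +ℤ_) (support≡dot v)

triple : ℕ → ℕ → ℕ → ℕ → Trit
triple i j l = spike i pos (spike j neg (spike l pos zeros))

module _ {i j l : ℕ} (i<j : i < j) (j<l : j < l) where

  private
    i<l = <-trans i<j j<l
    e_l = spike l pos zeros
    e_l−e_j = spike j neg e_l

  triple-i : triple i j l i ≡ pos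
  triple-i = spike-at i pos e_l−e_j

  triple-j : triple i j l j ≡ neg
  triple-j = trans (spike-off pos e_l−e_j (>⇒≢ i<j)) (spike-at j neg e_l)

  triple-l : triple i j l l ≡ pos
  triple-l = trans (spike-off pos e_l−e_j (>⇒≢ i<l))
               (trans (spike-off neg e_l (>⇒≢ j<l)) (spike-at l pos zeros))

  triple-below : ∀ {t} → t < i → triple i j l t ≡ zer
  triple-below t<i = trans (spike-off pos e_l−e_j (<⇒≢ t<i))
                       (trans (spike-off neg e_l (<⇒≢ (<-trans t<i i<j)))
                              (spike-off pos zeros (<⇒≢ (<-trans t<i i<l))))

  dot-triple : ∀ {n} g → l < n → dot (vec n (triple i j l)) (vec n g) ≡
               toℤ pos *ℤ toℤ (g i) +ℤ (toℤ neg *ℤ toℤ (g j) +ℤ (toℤ pos *ℤ toℤ (g l) +ℤ ℤ.+ 0))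
  dot-triple {n} g l<n = begin
    dot (vec n (triple i j l)) (vec n g)
      ≡⟨ dot-spike pos e_l−e_j g (<-trans i<l l<n)
           (trans (spike-off neg e_l (<⇒≢ i<j)) (spike-off pos zeros (<⇒≢ i<l))) ⟩
    a +ℤ dot (vec n e_l−e_j) (vec n g)
      ≡⟨ cong (a +ℤ_) (dot-spike neg e_l g (<-trans j<l l<n) (spike-off pos zeros (<⇒≢ j<l))) ⟩
    a +ℤ (b +ℤ dot (vec n e_l) (vec n g))
      ≡⟨ cong (λ z → a +ℤ (b +ℤ z)) (dot-spike pos zeros g l<n refl) ⟩
    a +ℤ (b +ℤ (c +ℤ dot (vec n zeros) (vec n g)))
      ≡⟨ cong (λ z → a +ℤ (b +ℤ (c +ℤ z))) (dot-zerosˡ n g) ⟩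
    a +ℤ (b +ℤ (c +ℤ ℤ.+ 0)) ∎
    where
    open ≡-Reasoning
    a = toℤ pos *ℤ toℤ (g i)
    b = toℤ neg *ℤ toℤ (g j)
    c = toℤ pos *ℤ toℤ (g l)

  support-triple : ∀ {n} → l < n → support (vec n (triple i j l)) ≡ 3
  support-triple {n} l<n = ℤ.+-injective (trans (support≡dot (vec n (triple i j l)))
    (trans (dot-triple (triple i j l) l<n) (evaluate triple-i triple-j triple-l)))
    where
    evaluate : ∀ {x y z} → x ≡ pos → y ≡ neg → z ≡ pos →
               toℤ pos *ℤ toℤ x +ℤ (toℤ neg *ℤ toℤ y +ℤ (toℤ pos *ℤ toℤ z +ℤ ℤ.+ 0)) ≡ ℤ.+ 3
    evaluate refl refl refl = refl

adjacent-triples : ∀ {n i j l m} → i < j → j < l → l < m → m < n →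
                   dot (vec n (triple i j l)) (vec n (triple j l m)) ≡ -[1+ 1 ]
adjacent-triples i<j j<l l<m m<n =
  trans (dot-triple i<j j<l (triple _ _ _) (<-trans l<m m<n))
        (evaluate (triple-below j<l l<m i<j) (triple-i j<l l<m) (triple-j j<l l<m))
  where
  evaluate : ∀ {x y z} → x ≡ zer → y ≡ pos → z ≡ neg →
             toℤ pos *ℤ toℤ x +ℤ (toℤ neg *ℤ toℤ y +ℤ (toℤ pos *ℤ toℤ z +ℤ ℤ.+ 0)) ≡ -[1+ 1 ]
  evaluate refl refl refl = refl

-- The columns of two vertices

sign : Trit → Maybe Sign
sign neg = just Sign.-
sign zer = nothing
sign pos = just Sign.+

consAt : ∀ {A : Set} → ℕ → Maybe A → List (ℕ × A) → List (ℕ × A)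
consAt k nothing  xs = xs
consAt k (just x) xs = (k , x) ∷ xs

entries : ∀ {n} → ℕ → Vec Trit n → List (ℕ × Sign)
entries k []      = []
entries k (x ∷ v) = consAt k (sign x) (entries (suc k) v)

signs : ∀ {n} → Vec Trit n → List Sign
signs v = map proj₂ (entries 0 v)

positions : ∀ {n} → ℕ → Vec Trit n → List ℕ
positions k v = map proj₁ (entries k v)

support≡length-signs : ∀ {n} (v : Vec Trit n) → support v ≡ length (signs v)
support≡length-signs = go 0
  where
  go : ∀ {n} k (v : Vec Trit n) → support v ≡ length (map proj₂ (entries k v))
  go k []        = refl
  go k (neg ∷ v) = cong suc (go (suc k) v)
  go k (zer ∷ v) = go (suc k) v
  go k (pos ∷ v) = cong suc (go (suc k) v)

positions-≥ : ∀ {n} k (v : Vec Trit n) → All (k ≤_) (positions k v)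
positions-≥ k []        = []
positions-≥ k (neg ∷ v) = ≤-refl ∷ All.map <⇒≤ (positions-≥ (suc k) v)
positions-≥ k (zer ∷ v) = All.map <⇒≤ (positions-≥ (suc k) v)
positions-≥ k (pos ∷ v) = ≤-refl ∷ All.map <⇒≤ (positions-≥ (suc k) v)

positions-increasing : ∀ {n} k (v : Vec Trit n) → AllPairs _<_ (positions k v)
positions-increasing k []        = []
positions-increasing k (neg ∷ v) = positions-≥ (suc k) v ∷ positions-increasing (suc k) v
positions-increasing k (zer ∷ v) = positions-increasing (suc k) v
positions-increasing k (pos ∷ v) = positions-≥ (suc k) v ∷ positions-increasing (suc k) v

positions-< : ∀ {n} k (v : Vec Trit n) → All (_< k + n) (positions k v)
positions-< k [] = []
positions-< {suc n} k (x ∷ v) =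
  subst (λ b → All (_< b) (positions k (x ∷ v))) (sym (+-suc k n)) (bound x)
  where
  bound : ∀ y → All (_< suc k + n) (positions k (y ∷ v))
  bound neg = s≤s (m≤m+n k n) ∷ positions-< (suc k) v
  bound zer = positions-< (suc k) v
  bound pos = s≤s (m≤m+n k n) ∷ positions-< (suc k) v

-- A nonzero column of the 2 × n matrix with rows v and w.
data Column : Set where
  left  : Sign → Column
  right : Sign → Column
  both  : Sign → Sign → Column

leftSign : Column → Maybe Sign
leftSign (left s)   = just s
leftSign (right _)  = nothing
leftSign (both s _) = just s

rightSign : Column → Maybe Sign
rightSign (left _)   = nothing
rightSign (right t)  = just t
rightSign (both _ t) = just t

joinSigns : Maybe Sign → Maybe Sign → Maybe Column
joinSigns nothing  nothing  = nothing
joinSigns (just s) nothing  = just (left s)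
joinSigns nothing  (just t) = just (right t)
joinSigns (just s) (just t) = just (both s t)

columns : ∀ {n} → ℕ → Vec Trit n → Vec Trit n → List (ℕ × Column)
columns k []      []      = []
columns k (x ∷ v) (y ∷ w) = consAt k (joinSigns (sign x) (sign y)) (columns (suc k) v w)

row : (Column → Maybe Sign) → List (ℕ × Column) → List (ℕ × Sign)
row r []             = []
row r ((k , c) ∷ cs) = consAt k (r c) (row r cs)

row-consAt : ∀ r k (mc : Maybe Column) cs → row r (consAt k mc cs) ≡ consAt k (mc >>= r) (row r cs)
row-consAt r k nothing  cs = refl
row-consAt r k (just c) cs = refl

row-left : ∀ {n} k (v w : Vec Trit n) → row leftSign (columns k v w) ≡ entries k v
row-left k []      []      = refl
row-left k (x ∷ v) (y ∷ w) =
  trans (row-consAt leftSign k (joinSigns (sign x) (sign y)) (columns (suc k) v w))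
    (cong₂ (consAt k) (leftSign-join (sign x) (sign y)) (row-left (suc k) v w))
  where
  leftSign-join : ∀ a b → (joinSigns a b >>= leftSign) ≡ a
  leftSign-join nothing  nothing  = refl
  leftSign-join (just _) nothing  = refl
  leftSign-join nothing  (just _) = refl
  leftSign-join (just _) (just _) = refl

row-right : ∀ {n} k (v w : Vec Trit n) → row rightSign (columns k v w) ≡ entries k w
row-right k []      []      = refl
row-right k (x ∷ v) (y ∷ w) =
  trans (row-consAt rightSign k (joinSigns (sign x) (sign y)) (columns (suc k) v w))
    (cong₂ (consAt k) (rightSign-join (sign x) (sign y)) (row-right (suc k) v w))
  where
  rightSign-join : ∀ a b → (joinSigns a b >>= rightSign) ≡ b
  rightSign-join nothing  nothing  = refl
  rightSign-join (just _) nothing  = refl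
  rightSign-join nothing  (just _) = refl
  rightSign-join (just _) (just _) = refl

map-proj₂-row : ∀ r cs → map proj₂ (row r cs) ≡ mapMaybe r (map proj₂ cs)
map-proj₂-row r [] = refl
map-proj₂-row r ((k , c) ∷ cs) with r c
... | nothing = map-proj₂-row r cs
... | just s  = cong (s ∷_) (map-proj₂-row r cs)

columnProduct : Column → ℤ
columnProduct (both s t) = (s Sign.* t) ◃ 1
columnProduct _          = ℤ.+ 0

columnDot : List Column → ℤ
columnDot []       = ℤ.+ 0
columnDot (c ∷ cs) = columnProduct c +ℤ columnDot cs

dot-columns : ∀ {n} k (v w : Vec Trit n) → dot v w ≡ columnDot (map proj₂ (columns k v w))
dot-columns k []      []      = refl
dot-columns k (x ∷ v) (y ∷ w) =
  trans (cong₂ _+ℤ_ (product x y) (dot-columns (suc k) v w))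
        (columnDot-consAt (joinSigns (sign x) (sign y)) (columns (suc k) v w))
  where
  product : ∀ x y → toℤ x *ℤ toℤ y ≡ maybe columnProduct (ℤ.+ 0) (joinSigns (sign x) (sign y))
  product neg neg = refl
  product neg zer = refl
  product neg pos = refl
  product zer neg = refl
  product zer zer = refl
  product zer pos = refl
  product pos neg = refl
  product pos zer = refl
  product pos pos = refl
  columnDot-consAt : ∀ mc cs → maybe columnProduct (ℤ.+ 0) mc +ℤ columnDot (map proj₂ cs)
                               ≡ columnDot (map proj₂ (consAt k mc cs))
  columnDot-consAt nothing  cs = ℤ.+-identityˡ _
  columnDot-consAt (just c) cs = refl

interleavings : List Sign → List Sign → List (List Column)
interleavings []       []       = [] ∷ []
interleavings (s ∷ ss) []       = map (left s ∷_) (interleavings ss [])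
interleavings []       (t ∷ ts) = map (right t ∷_) (interleavings [] ts)
interleavings (s ∷ ss) (t ∷ ts) =
  map (left s ∷_) (interleavings ss (t ∷ ts)) ++
  map (right t ∷_) (interleavings (s ∷ ss) ts) ++
  map (both s t ∷_) (interleavings ss ts)

∈-interleavings : ∀ cs → cs ∈ interleavings (mapMaybe leftSign cs) (mapMaybe rightSign cs)
∈-interleavings [] = here refl
∈-interleavings (left s ∷ cs) with mapMaybe rightSign cs | ∈-interleavings cs
... | []    | cs∈ = ∈-map⁺ (left s ∷_) cs∈
... | _ ∷ _ | cs∈ = ∈-++⁺ˡ (∈-map⁺ (left s ∷_) cs∈)
∈-interleavings (right t ∷ cs) with mapMaybe leftSign cs | ∈-interleavings cs
... | []    | cs∈ = ∈-map⁺ (right t ∷_) cs∈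
... | s ∷ ss | cs∈ =
  ∈-++⁺ʳ (map (left s ∷_) (interleavings ss (t ∷ mapMaybe rightSign cs)))
         (∈-++⁺ˡ (∈-map⁺ (right t ∷_) cs∈))
∈-interleavings (both s t ∷ cs) =
  ∈-++⁺ʳ viaLeft (∈-++⁺ʳ viaRight (∈-map⁺ (both s t ∷_) (∈-interleavings cs)))
  where
  viaLeft  = map (left s ∷_) (interleavings (mapMaybe leftSign cs) (t ∷ mapMaybe rightSign cs))
  viaRight = map (right t ∷_) (interleavings (s ∷ mapMaybe leftSign cs) (mapMaybe rightSign cs))

allSigns : List Sign
allSigns = Sign.- ∷ Sign.+ ∷ []

signTriples : List (List Sign)
signTriples = map toList (vectors allSigns 3)

signs∈signTriples : ∀ {n} (v : Vec Trit n) → support v ≡ 3 → signs v ∈ signTriples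
signs∈signTriples v support≡3 = subst (λ k → signs v ∈ map toList (vectors allSigns k)) length≡3
  (subst (_∈ map toList (vectors allSigns (length (signs v)))) (toList∘fromList (signs v))
         (∈-map⁺ toList (∈-vectors sign∈ (fromList (signs v)))))
  where
  length≡3 = trans (sym (support≡length-signs v)) support≡3
  sign∈ : ∀ s → s ∈ allSigns
  sign∈ Sign.- = here refl
  sign∈ Sign.+ = there (here refl)

signClass : List Sign → Fin 6 ⊎ Bool
signClass (Sign.+ ∷ Sign.+ ∷ Sign.+ ∷ []) = inj₁ (# 0)
signClass (Sign.+ ∷ Sign.+ ∷ Sign.- ∷ []) = inj₁ (# 1)
signClass (Sign.+ ∷ Sign.- ∷ Sign.- ∷ []) = inj₁ (# 2)
signClass (Sign.- ∷ Sign.+ ∷ Sign.+ ∷ []) = inj₁ (# 3)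
signClass (Sign.- ∷ Sign.- ∷ Sign.+ ∷ []) = inj₁ (# 4)
signClass (Sign.- ∷ Sign.- ∷ Sign.- ∷ []) = inj₁ (# 5)
signClass (Sign.+ ∷ Sign.- ∷ Sign.+ ∷ []) = inj₂ true
signClass (Sign.- ∷ Sign.+ ∷ Sign.- ∷ []) = inj₂ false
signClass _                               = inj₁ (# 0)

isAlternating : Fin 6 ⊎ Bool → Bool
isAlternating = [ const false , const true ]′

-- The supports of two vertices overlap like (i, j, l) and (j, l, m).
data Shifted : List Column → Set where
  leftShift  : ∀ {s₀ s₁ s₂ t₁ t₂ t₃} → Shifted (left s₀ ∷ both s₁ t₁ ∷ both s₂ t₂ ∷ right t₃ ∷ [])
  rightShift : ∀ {t₀ s₁ s₂ t₁ t₂ s₃} → Shifted (right t₀ ∷ both s₁ t₁ ∷ both s₂ t₂ ∷ left s₃ ∷ [])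

shifted? : (cs : List Column) → Maybe (Shifted cs)
shifted? (left _ ∷ both _ _ ∷ both _ _ ∷ right _ ∷ []) = just leftShift
shifted? (right _ ∷ both _ _ ∷ both _ _ ∷ left _ ∷ []) = just rightShift
shifted? _                                             = nothing

AdjacentSameClass⇒Shifted : List Sign → List Sign → List Column → Set
AdjacentSameClass⇒Shifted s t cs =
  columnDot cs ≡ -[1+ 1 ] → signClass s ≡ signClass t →
  T (isAlternating (signClass s)) × T (is-just (shifted? cs))

abstract
  adjacentSameClass⇒Shifted : All (λ s → All (λ t → All (AdjacentSameClass⇒Shifted s t)
                                (interleavings s t)) signTriples) signTriples
  adjacentSameClass⇒Shifted = toWitness {a? = All.all? (λ s → All.all? (λ t → All.all? (decide s t)
                                 (interleavings s t)) signTriples) signTriples} _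
    where
    decide : ∀ s t cs → Dec (AdjacentSameClass⇒Shifted s t cs)
    decide s t cs = columnDot cs ℤ.≟ -[1+ 1 ] →-dec
                    (Sum.≡-dec Fin._≟_ Bool._≟_ (signClass s) (signClass t) →-dec (T? _ ×-dec T? _))

signs≡leftSigns : ∀ {n} (v w : Vec Trit n) →
                  signs v ≡ mapMaybe leftSign (map proj₂ (columns 0 v w))
signs≡leftSigns v w =
  trans (cong (map proj₂) (sym (row-left 0 v w))) (map-proj₂-row leftSign (columns 0 v w))

signs≡rightSigns : ∀ {n} (v w : Vec Trit n) →
                   signs w ≡ mapMaybe rightSign (map proj₂ (columns 0 v w))
signs≡rightSigns v w =
  trans (cong (map proj₂) (sym (row-right 0 v w))) (map-proj₂-row rightSign (columns 0 v w))

adjacent-sameClass : ∀ {n} (v w : Vec Trit n) → support v ≡ 3 → support w ≡ 3 → dot v w ≡ -[1+ 1 ] →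
                     signClass (signs v) ≡ signClass (signs w) →
                     T (isAlternating (signClass (signs v))) × Shifted (map proj₂ (columns 0 v w))
adjacent-sameClass v w v∈ w∈ adjacent sameClass =
  map₂ (to-witness-T (shifted? cs)) (check cs∈ (trans (sym (dot-columns 0 v w)) adjacent) sameClass)
  where
  check = All.lookup (All.lookup (All.lookup adjacentSameClass⇒Shifted (signs∈signTriples v v∈))
                                                                      (signs∈signTriples w w∈))
  cs = map proj₂ (columns 0 v w)
  cs∈ : cs ∈ interleavings (signs v) (signs w)
  cs∈ = subst₂ (λ s t → cs ∈ interleavings s t)
          (sym (signs≡leftSigns v w)) (sym (signs≡rightSigns v w)) (∈-interleavings cs)

-- Colouring J±(n, 3, −2)

triColour : (ℕ → ℕ → ℕ → ℕ) → List (ℕ × Sign) → ℕ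
triColour c ((a , _) ∷ (b , _) ∷ (d , _) ∷ []) = c a b d
triColour c _                                   = 0

shifted-triColour : ∀ {N c} → IsShiftColouring₃ N c → ∀ ics → Shifted (map proj₂ ics) →
                    AllPairs _<_ (map proj₁ (row leftSign ics)) →
                    AllPairs _<_ (map proj₁ (row rightSign ics)) →
                    All (_< N) (map proj₁ (row leftSign ics)) →
                    All (_< N) (map proj₁ (row rightSign ics)) →
                    triColour c (row leftSign ics) ≢ triColour c (row rightSign ics)
shifted-triColour proper (_ ∷ _ ∷ _ ∷ _ ∷ []) leftShift
  ((p₀<p₁ ∷ _) ∷ (p₁<p₂ ∷ []) ∷ [] ∷ []) ((_ ∷ _) ∷ (p₂<p₃ ∷ []) ∷ [] ∷ []) _ (_ ∷ _ ∷ p₃<N ∷ []) =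
  proper p₀<p₁ p₁<p₂ p₂<p₃ p₃<N
shifted-triColour proper (_ ∷ _ ∷ _ ∷ _ ∷ []) rightShift
  ((p₁<p₂ ∷ _) ∷ (p₂<p₃ ∷ []) ∷ [] ∷ []) ((p₀<p₁ ∷ _) ∷ _ ∷ [] ∷ []) (_ ∷ _ ∷ p₃<N ∷ []) _ =
  proper p₀<p₁ p₁<p₂ p₂<p₃ p₃<N ∘ sym
shifted-triColour _ []                            ()
shifted-triColour _ (_ ∷ [])                      ()
shifted-triColour _ (_ ∷ _ ∷ [])                  ()
shifted-triColour _ (_ ∷ _ ∷ _ ∷ [])              ()
shifted-triColour _ (_ ∷ _ ∷ _ ∷ _ ∷ _ ∷ _)       ()

shifted-triColour′ : ∀ {n N c} → IsShiftColouring₃ N c → n ≤ N → (v w : Vec Trit n) →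
                     Shifted (map proj₂ (columns 0 v w)) →
                     triColour c (entries 0 v) ≢ triColour c (entries 0 w)
shifted-triColour′ {n} {N} {c} proper n≤N v w shifted =
  shifted-triColour proper cs shifted
    (onLeft (AllPairs _<_) (positions-increasing 0 v))
    (onRight (AllPairs _<_) (positions-increasing 0 w))
    (onLeft (All (_< N)) (bounded v)) (onRight (All (_< N)) (bounded w))
  ∘ subst₂ (λ e f → triColour c e ≡ triColour c f) (sym (row-left 0 v w)) (sym (row-right 0 v w))
  where
  cs = columns 0 v w
  onLeft : ∀ (P : List ℕ → Set) → P (positions 0 v) → P (map proj₁ (row leftSign cs))
  onLeft P = subst (P ∘ map proj₁) (sym (row-left 0 v w))
  onRight : ∀ (P : List ℕ → Set) → P (positions 0 w) → P (map proj₁ (row rightSign cs))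
  onRight P = subst (P ∘ map proj₁) (sym (row-right 0 v w))
  bounded : ∀ (u : Vec Trit n) → All (_< N) (positions 0 u)
  bounded u = All.map (λ p<n → <-≤-trans p<n n≤N) (positions-< 0 u)

paint : Fin 6 ⊎ Bool → ℕ → ℕ
paint (inj₁ c) _ = toℕ c
paint (inj₂ b) x = 6 + consBit b x

paint-< : ∀ k {x d} → x < d → paint k x < 6 + (d + d)
paint-< (inj₁ c) _   = ≤-trans (Fin.toℕ<n c) (m≤m+n 6 _)
paint-< (inj₂ b) x<d = +-monoʳ-< 6 (consBit-< b x<d)

paint-injectiveˡ : ∀ k k′ {x x′} → paint k x ≡ paint k′ x′ → k ≡ k′
paint-injectiveˡ (inj₁ c) (inj₁ c′) same = cong inj₁ (Fin.toℕ-injective same)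
paint-injectiveˡ (inj₁ c) (inj₂ _)  same =
  contradiction (m≤m+n 6 _) (<⇒≱ (subst (_< 6) same (Fin.toℕ<n c)))
paint-injectiveˡ (inj₂ _) (inj₁ c′) same =
  contradiction (m≤m+n 6 _) (<⇒≱ (subst (_< 6) (sym same) (Fin.toℕ<n c′)))
paint-injectiveˡ (inj₂ b) (inj₂ b′) {x} {x′} same =
  cong inj₂ (proj₁ (consBit-injective b x b′ x′ (+-cancelˡ-≡ 6 _ _ same)))

paint-injectiveʳ : ∀ k {x x′} → T (isAlternating k) → paint k x ≡ paint k x′ → x ≡ x′
paint-injectiveʳ (inj₂ b) {x} {x′} _ same =
  proj₂ (consBit-injective b x b x′ (+-cancelˡ-≡ 6 _ _ same))

triColour-< : ∀ {c d} → 0 < d → (∀ a b e → c a b e < d) → ∀ es → triColour c es < d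
triColour-< _   c< ((a , _) ∷ (b , _) ∷ (e , _) ∷ []) = c< a b e
triColour-< d>0 _  []                                 = d>0
triColour-< d>0 _  (_ ∷ [])                           = d>0
triColour-< d>0 _  (_ ∷ _ ∷ [])                       = d>0
triColour-< d>0 _  (_ ∷ _ ∷ _ ∷ _ ∷ _)                = d>0

vertexColour : ∀ {n} → ℕ → ℕ → Vec Trit n → ℕ
vertexColour m l v = paint (signClass (signs v)) (triColour (bitColour₃ m l) (entries 0 v))

vertexColour-< : ∀ {n m l} → 0 < l → (v : Vec Trit n) → vertexColour m l v < 6 + ((l + l) + (l + l))
vertexColour-< {m = m} {l} l>0 v = paint-< (signClass (signs v))
  (triColour-< {c = bitColour₃ m l} (≤-trans l>0 (m≤m+n _ _)) (λ a b e → bitColour₃-< {m} a b e l>0)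
               (entries 0 v))

vertexColour-proper : ∀ {n m l} → 0 < m → m ≤ 2 ^ l → n ≤ 2 ^ m → (v w : Vec Trit n) →
                      support v ≡ 3 → support w ≡ 3 → dot v w ≡ -[1+ 1 ] →
                      vertexColour m l v ≢ vertexColour m l w
vertexColour-proper {m = m} {l} m>0 m≤2^l n≤2^m v w v∈ w∈ adjacent sameColour =
  shifted-triColour′ (bitColour₃-shift m>0 m≤2^l) n≤2^m v w shifted
    (paint-injectiveʳ class alternating (trans sameColour (cong (λ k → paint k _) (sym sameClass))))
  where
  class = signClass (signs v)
  sameClass = paint-injectiveˡ class (signClass (signs w)) sameColour
  alternating = proj₁ (adjacent-sameClass v w v∈ w∈ adjacent sameClass)
  shifted = proj₂ (adjacent-sameClass v w v∈ w∈ adjacent sameClass)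

J±-chromaticNumber : ∀ n {K} → ProperColouring (J± n) K → ∃[ χ ] IsChromaticNumber (J± n) χ × χ ≤ K
J±-chromaticNumber n = FiniteGraph.chromaticNumber (J± n) vertices vertex∈
                         (λ x y → dot (proj₁ x) (proj₁ y) ℤ.≟ -[1+ 1 ])
  where
  support≡3? = λ (v : Vec Trit n) → support v ≟ 3
  trit∈ : ∀ x → x ∈ neg ∷ zer ∷ pos ∷ []
  trit∈ neg = here refl
  trit∈ zer = there (here refl)
  trit∈ pos = there (there (here refl))
  vertices = withProofs support≡3? (vectors (neg ∷ zer ∷ pos ∷ []) n)
  vertex∈ : ∀ x → x ∈ vertices
  vertex∈ (v , p) = ∈-withProofs support≡3? ≡-irrelevant p (∈-vectors trit∈ v)

6+[[l+l]+[l+l]]≡4l+6 : ∀ l → 6 + ((l + l) + (l + l)) ≡ 4 * l + 6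
6+[[l+l]+[l+l]]≡4l+6 = solve-∀

J±-colouring : ∀ n → 3 ≤ n → ProperColouring (J± n) (4 * ⌈log₂ ⌈log₂ n ⌉ ⌉ + 6)
J±-colouring n 3≤n = subst (ProperColouring (J± n)) (6+[[l+l]+[l+l]]≡4l+6 l)
  (boundedColouring colour (λ (v , _) → vertexColour-< {m = m} l>0 v)
    (λ (v , v∈) (w , w∈) → vertexColour-proper m>0 (n≤2^⌈log₂n⌉ m) (n≤2^⌈log₂n⌉ n) v w v∈ w∈))
  where
  m = ⌈log₂ n ⌉
  l = ⌈log₂ m ⌉
  m≥2 : 2 ≤ m
  m≥2 = ⌈log₂⌉-mono-≤ 3≤n
  m>0 : 0 < m
  m>0 = <-≤-trans z<s m≥2
  l>0 : 0 < l
  l>0 = ⌈log₂⌉-mono-≤ m≥2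
  colour : V (J± n) → ℕ
  colour (v , _) = vertexColour m l v

-- The vertex e_i − e_j + e_l; a fixed vertex stands in when i < j < l < n fails.
tripleVertex : ∀ n → 3 ≤ n → ℕ → ℕ → ℕ → V (J± n)
tripleVertex n 3≤n i j l with support (vec n (triple i j l)) ≟ 3
... | yes support≡3 = vec n (triple i j l) , support≡3
... | no _          = vec n (triple 0 1 2) , support-triple z<s (s<s z<s) 3≤n

tripleVertex-vec : ∀ {n} 3≤n {i j l} → i < j → j < l → l < n →
                   proj₁ (tripleVertex n 3≤n i j l) ≡ vec n (triple i j l)
tripleVertex-vec {n} 3≤n {i} {j} {l} i<j j<l l<n with support (vec n (triple i j l)) ≟ 3
... | yes _    = refl
... | no  ≢3   = contradiction (support-triple i<j j<l l<n) ≢3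

J±-colours-≥ : ∀ n → 3 ≤ n → ∀ {k} → ProperColouring (J± n) k → ⌈log₂ ⌈log₂ n ⌉ ⌉ ≤ k
J±-colours-≥ n 3≤n (c , proper) = n≤2^2^k⇒⌈log₂⌈log₂n⌉⌉≤k (shift₃-lower _ shift)
  where
  shift : IsShiftColouring₃ n (λ i j l → c (tripleVertex n 3≤n i j l))
  shift i<j j<l l<m m<n = proper _ _ (subst₂ (λ v w → dot v w ≡ -[1+ 1 ])
    (sym (tripleVertex-vec 3≤n i<j j<l (<-trans l<m m<n))) (sym (tripleVertex-vec 3≤n j<l l<m m<n))
    (adjacent-triples i<j j<l l<m m<n))

theorem3 : ∀ (n : ℕ) → 3 ≤ n →
    ∃[ χ ] (IsChromaticNumber (J± n) χ
      × ⌈log₂ ⌈log₂ n ⌉ ⌉ ≤ χ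
      × χ ≤ 4 * ⌈log₂ ⌈log₂ n ⌉ ⌉ + 6)
theorem3 n 3≤n =
  let χ , isχ , χ≤ = J±-chromaticNumber n (J±-colouring n 3≤n)
  in  χ , isχ , J±-colours-≥ n 3≤n (proj₁ isχ) , χ≤
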